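{- For every FPC type $\Theta\vdash\mu\alpha.\tau$ and every environment $\rho:\mathcal U^{|\Theta|}$, $[\![\Theta\vdash\mu\alpha.\tau]\!](\rho)=\triangleright\big([\![\Theta\vdash\tau[\mu\alpha.\tau/\alpha]]\!](\rho)\big)$.
   Context: Work in Guarded Dependent Type Theory (GDTT): for the (implicit) clock there is a type former $\triangleright$ ("later") with $\mathrm{next}:A\to\triangleright A$, later application $\circledast:\triangleright(A\to B)\to\triangleright A\to\triangleright B$ with $\mathrm{next}(f)\circledast\mathrm{next}(t)\equiv\mathrm{next}(f\,t)$, a guarded fixed point combinator $\mathrm{fix}:(\triangleright A\to A)\to A$ with $\mathrm{fix}\,f=f(\mathrm{next}(\mathrm{fix}\,f))$, and a universe $\mathcal U$ (codes identified with their types) containing $\hat\triangleright:\triangleright\mathcal U\to\mathcal U$ with $\hat\triangleright(\mathrm{next}\,A)\equiv\triangleright A$. $=$ is propositional equality. FPC types in a context $\Theta$ of type variables: $\tau::=\alpha\mid1\mid\tau_1\times\tau_2\mid\tau_1+\tau_2\mid\tau_1\to\tau_2\mid\mu\alpha.\tau$. For a small type $A$, $LA$ is the guarded recursive type with $LA\cong A+\triangleright LA$. The interpretation $[\![\Theta\vdash\tau]\!]:\mathcal U^{|\Theta|}\to\mathcal U$: $[\![\alpha]\!](\rho)=\rho(\alpha)$; $[\![1]\!](\rho)=L1$; $[\![\tau_1\times\tau_2]\!](\rho)=[\![\tau_1]\!](\rho)\times[\![\tau_2]\!](\rho)$; $[\![\tau_1+\tau_2]\!](\rho)=L([\![\tau_1]\!](\rho)+[\![\tau_2]\!](\rho))$;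 $[\![\tau_1\to\tau_2]\!](\rho)=[\![\tau_1]\!](\rho)\to[\![\tau_2]\!](\rho)$; $[\![\Theta\vdash\mu\alpha.\tau]\!]$ is defined by guarded recursion (via $\mathrm{fix}$ on codes) so that $[\![\Theta\vdash\mu\alpha.\tau]\!](\rho)\equiv\triangleright([\![\Theta,\alpha\vdash\tau]\!](\rho,[\![\Theta\vdash\mu\alpha.\tau]\!](\rho)))$. -}

module Defs where

open import Level using (Level; _⊔_; Setω) renaming (suc to lsuc)
open import Data.Nat using (ℕ; zero; suc)
open import Data.Fin using (Fin; zero; suc)
open import Data.Unit using (⊤)
open import Data.Product using (_×_)
open import Data.Sum using (_⊎_)
open import Relation.Binary.PropositionalEquality using (_≡_)

-- GDTT (single implicit clock), given abstractly as a record of its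
-- primitives. The universe 𝒰 is Agda's Set (codes identified with
-- types). Judgemental equalities of GDTT are rendered as propositional
-- equalities. Function extensionality and the extensionality principle
-- for later (▹(x = y) → next x = next y) are standard parts of GDTT.

record GDTT : Setω where
  field
    ▹     : ∀ {ℓ} → Set ℓ → Set ℓ
    next  : ∀ {ℓ} {A : Set ℓ} → A → ▹ A
    _⊛_   : ∀ {ℓ ℓ'} {A : Set ℓ} {B : Set ℓ'} → ▹ (A → B) → ▹ A → ▹ B
    next-⊛ : ∀ {ℓ ℓ'} {A : Set ℓ} {B : Set ℓ'} (f : A → B) (t : A) →
             (next f ⊛ next t) ≡ next (f t)
    fix   : ∀ {ℓ} {A : Set ℓ} → (▹ A → A) → A
    fix-eq : ∀ {ℓ} {A : Set ℓ} (f : ▹ A → A) → fix f ≡ f (next (fix f))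
    ▹̂     : ▹ Set → Set
    ▹̂-next : (A : Set) → ▹̂ (next A) ≡ ▹ A
    later-ext : ∀ {ℓ} {A : Set ℓ} {x y : A} → ▹ (x ≡ y) → next x ≡ next y
    funext : ∀ {ℓ ℓ'} {A : Set ℓ} {B : A → Set ℓ'} {f g : (x : A) → B x} →
             ((x : A) → f x ≡ g x) → f ≡ g

-- FPC types in a context Θ of n type variables (de Bruijn; in Θ,α the
-- newest variable α is `zero`).

data Ty (n : ℕ) : Set where
  var  : Fin n → Ty n
  one  : Ty n
  _⊗_  : Ty n → Ty n → Ty n
  _⊕_  : Ty n → Ty n → Ty n
  _⇒_  : Ty n → Ty n → Ty n
  μ    : Ty (suc n) → Ty n

liftRen : ∀ {n m} → (Fin n → Fin m) → Fin (suc n) → Fin (suc m)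
liftRen r zero    = zero
liftRen r (suc i) = suc (r i)

ren : ∀ {n m} → (Fin n → Fin m) → Ty n → Ty m
ren r (var i)   = var (r i)
ren r one       = one
ren r (a ⊗ b)   = ren r a ⊗ ren r b
ren r (a ⊕ b)   = ren r a ⊕ ren r b
ren r (a ⇒ b)   = ren r a ⇒ ren r b
ren r (μ a)     = μ (ren (liftRen r) a)

liftSub : ∀ {n m} → (Fin n → Ty m) → Fin (suc n) → Ty (suc m)
liftSub s zero    = var zero
liftSub s (suc i) = ren suc (s i)

sub : ∀ {n m} → (Fin n → Ty m) → Ty n → Ty m
sub s (var i)   = s i
sub s one       = one
sub s (a ⊗ b)   = sub s a ⊗ sub s b
sub s (a ⊕ b)   = sub s a ⊕ sub s b
sub s (a ⇒ b)   = sub s a ⇒ sub s b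
sub s (μ a)     = μ (sub (liftSub s) a)

_[_] : ∀ {n} → Ty (suc n) → Ty n → Ty n
τ [ σ ] = sub s τ
  where
  s : Fin (suc _) → Ty _
  s zero    = σ
  s (suc i) = var i

Env : ℕ → Set₁
Env n = Fin n → Set

_,,_ : ∀ {n} → Env n → Set → Env (suc n)
(ρ ,, A) zero    = A
(ρ ,, A) (suc i) = ρ i

module Sem (G : GDTT) where
  open GDTT G

  -- L A := fix (λ X. A + ▹̂ X), so that L A ≅ A + ▹ (L A)
  L : Set → Set
  L A = fix (λ X → A ⊎ ▹̂ X)

  ⟦_⟧ : ∀ {n} → Ty n → Env n → Set
  ⟦ var i ⟧ ρ = ρ i
  ⟦ one ⟧ ρ   = L ⊤
  ⟦ a ⊗ b ⟧ ρ = ⟦ a ⟧ ρ × ⟦ b ⟧ ρ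
  ⟦ a ⊕ b ⟧ ρ = L (⟦ a ⟧ ρ ⊎ ⟦ b ⟧ ρ)
  ⟦ a ⇒ b ⟧ ρ = ⟦ a ⟧ ρ → ⟦ b ⟧ ρ
  ⟦ μ a ⟧ ρ   = fix (λ X → ▹̂ (next (λ A → ⟦ a ⟧ (ρ ,, A)) ⊛ X))

-- For any type operator F, the type
--    νF := fix (λ X. ▹̂ (next F ⊛ X)) satisfies νF = ▹ (F νF); this uses
--    only fix-eq, next-⊛ and ▹̂-next.  Since ⟦ μα.τ ⟧ρ is ν of
--    A ↦ ⟦ τ ⟧(ρ,A), it equals ▹ ⟦ τ ⟧(ρ, ⟦ μα.τ ⟧ρ).
--  * The semantic substitution lemma: ⟦ sub s τ ⟧ρ = ⟦ τ ⟧ρ' whenever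
--    ⟦ s i ⟧ρ = ρ' i for all i.
--    Specialised to single substitution it gives
--    ⟦ τ[σ/α] ⟧ρ = ⟦ τ ⟧(ρ, ⟦ σ ⟧ρ).
module Submission where

open import Defs
open import Data.Nat using (ℕ; suc)
open import Data.Fin using (Fin; zero; suc)
open import Data.Product using (_×_)
open import Data.Sum using (_⊎_)
open import Relation.Binary.PropositionalEquality
  using (_≡_; refl; cong; cong₂; sym; trans; module ≡-Reasoning)

module Unfolding (G : GDTT) where
  open GDTT G
  open Sem G

  ν : (Set → Set) → Set
  ν F = fix (λ X → ▹̂ (next F ⊛ X))

  ν-unfold : (F : Set → Set) → ν F ≡ ▹ (F (ν F))
  ν-unfold F = begin
    ν F                           ≡⟨ fix-eq (λ X → ▹̂ (next F ⊛ X)) ⟩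
    ▹̂ (next F ⊛ next (ν F))       ≡⟨ cong ▹̂ (next-⊛ F (ν F)) ⟩
    ▹̂ (next (F (ν F)))            ≡⟨ ▹̂-next (F (ν F)) ⟩
    ▹ (F (ν F))                   ∎
    where open ≡-Reasoning

  ⟦μ⟧-cong : ∀ {n n'} (a : Ty (suc n)) (b : Ty (suc n')) (ρ : Env n) (ρ' : Env n') →
             (∀ A → ⟦ a ⟧ (ρ ,, A) ≡ ⟦ b ⟧ (ρ' ,, A)) → ⟦ μ a ⟧ ρ ≡ ⟦ μ b ⟧ ρ'
  ⟦μ⟧-cong a b ρ ρ' h = cong ν (funext h)

  ⟦ren⟧ : ∀ {n m} (r : Fin n → Fin m) (τ : Ty n) (ρ : Env m) (ρ' : Env n) →
          (∀ i → ρ (r i) ≡ ρ' i) → ⟦ ren r τ ⟧ ρ ≡ ⟦ τ ⟧ ρ'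
  ⟦ren⟧ r (var i) ρ ρ' h = h i
  ⟦ren⟧ r one     ρ ρ' h = refl
  ⟦ren⟧ r (a ⊗ b) ρ ρ' h = cong₂ _×_ (⟦ren⟧ r a ρ ρ' h) (⟦ren⟧ r b ρ ρ' h)
  ⟦ren⟧ r (a ⊕ b) ρ ρ' h = cong L (cong₂ _⊎_ (⟦ren⟧ r a ρ ρ' h) (⟦ren⟧ r b ρ ρ' h))
  ⟦ren⟧ r (a ⇒ b) ρ ρ' h = cong₂ (λ X Y → X → Y) (⟦ren⟧ r a ρ ρ' h) (⟦ren⟧ r b ρ ρ' h)
  ⟦ren⟧ r (μ a)   ρ ρ' h = ⟦μ⟧-cong (ren (liftRen r) a) a ρ ρ'
    (λ A → ⟦ren⟧ (liftRen r) a (ρ ,, A) (ρ' ,, A) (lift-agrees A))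
    where
    lift-agrees : ∀ A i → (ρ ,, A) (liftRen r i) ≡ (ρ' ,, A) i
    lift-agrees A zero    = refl
    lift-agrees A (suc i) = h i

  ⟦weaken⟧ : ∀ {n} (σ : Ty n) (ρ : Env n) (A : Set) → ⟦ ren suc σ ⟧ (ρ ,, A) ≡ ⟦ σ ⟧ ρ
  ⟦weaken⟧ σ ρ A = ⟦ren⟧ suc σ (ρ ,, A) ρ (λ _ → refl)

  ⟦sub⟧ : ∀ {n m} (s : Fin n → Ty m) (τ : Ty n) (ρ : Env m) (ρ' : Env n) →
          (∀ i → ⟦ s i ⟧ ρ ≡ ρ' i) → ⟦ sub s τ ⟧ ρ ≡ ⟦ τ ⟧ ρ'
  ⟦sub⟧ s (var i) ρ ρ' h = h i
  ⟦sub⟧ s one     ρ ρ' h = refl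
  ⟦sub⟧ s (a ⊗ b) ρ ρ' h = cong₂ _×_ (⟦sub⟧ s a ρ ρ' h) (⟦sub⟧ s b ρ ρ' h)
  ⟦sub⟧ s (a ⊕ b) ρ ρ' h = cong L (cong₂ _⊎_ (⟦sub⟧ s a ρ ρ' h) (⟦sub⟧ s b ρ ρ' h))
  ⟦sub⟧ s (a ⇒ b) ρ ρ' h = cong₂ (λ X Y → X → Y) (⟦sub⟧ s a ρ ρ' h) (⟦sub⟧ s b ρ ρ' h)
  ⟦sub⟧ s (μ a)   ρ ρ' h = ⟦μ⟧-cong (sub (liftSub s) a) a ρ ρ'
    (λ A → ⟦sub⟧ (liftSub s) a (ρ ,, A) (ρ' ,, A) (lift-agrees A))
    where
    lift-agrees : ∀ A i → ⟦ liftSub s i ⟧ (ρ ,, A) ≡ (ρ' ,, A) i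
    lift-agrees A zero    = refl
    lift-agrees A (suc i) = trans (⟦weaken⟧ (s i) ρ A) (h i)

  ⟦[]⟧ : ∀ {n} (τ : Ty (suc n)) (σ : Ty n) (ρ : Env n) →
         ⟦ τ [ σ ] ⟧ ρ ≡ ⟦ τ ⟧ (ρ ,, ⟦ σ ⟧ ρ)
  ⟦[]⟧ τ σ ρ = ⟦sub⟧ _ τ ρ (ρ ,, ⟦ σ ⟧ ρ) λ { zero → refl ; (suc i) → refl }

  μ-unfold : ∀ {n} (τ : Ty (suc n)) (ρ : Env n) → ⟦ μ τ ⟧ ρ ≡ ▹ (⟦ τ [ μ τ ] ⟧ ρ)
  μ-unfold τ ρ = begin
    ⟦ μ τ ⟧ ρ                          ≡⟨ ν-unfold (λ A → ⟦ τ ⟧ (ρ ,, A)) ⟩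
    ▹ (⟦ τ ⟧ (ρ ,, ⟦ μ τ ⟧ ρ))          ≡⟨ cong ▹ (sym (⟦[]⟧ τ (μ τ) ρ)) ⟩
    ▹ (⟦ τ [ μ τ ] ⟧ ρ)                 ∎
    where open ≡-Reasoning

lemma4p2 : (G : GDTT) → {n : ℕ} (τ : Ty (suc n)) (ρ : Env n) →
    Sem.⟦_⟧ G (μ τ) ρ ≡ GDTT.▹ G (Sem.⟦_⟧ G (τ [ μ τ ]) ρ)
lemma4p2 G = Unfolding.μ-unfold G
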